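{- Let $\ell \geq 2$ and let $Y$ be the graph with vertices $p_1, \ldots, p_\ell, u_1, u_2$ consisting of the path $p_1, p_2, \ldots, p_\ell$ together with the edges $\{p_\ell, u_1\}$ and $\{p_\ell, u_2\}$. Let $t \geq 2$ and $1 \leq k_1 \leq \cdots \leq k_t$ be integers with $k_1 + \cdots + k_t = \ell$, and let $K_{2,k_1,\ldots,k_t}$ be the complete $(t+1)$-partite graph on vertex set $[\ell+2]$ whose first partition class is $\{1,2\}$ and whose other classes have sizes $k_1,\ldots,k_t$. Then for every bijection $\sigma: V(Y) \to [\ell+2]$, the vertices $1$ and $2$ are $(Y, K_{2,k_1,\ldots,k_t})$-exchangeable from $\sigma$.
   Context: All graphs are simple. For graphs $X, Y$ on $n$ vertices, an $(X,Y)$-friendly swap transforms a bijection $\sigma: V(X)\to V(Y)$ into $\sigma'$ where, for some edge $\{a,b\} \in E(X)$ with $\{\sigma(a),\sigma(b)\} \in E(Y)$, $\sigma'(a)=\sigma(b)$, $\sigma'(b)=\sigma(a)$ and $\sigma'(c)=\sigma(c)$ otherwise. For a bijection $\sigma$ and $u, v \in V(Y)$, $u$ and $v$ are $(X,Y)$-exchangeable from $\sigma$ if some sequence of $(X,Y)$-friendly swaps takes $\sigma$ to $(u\; v)\circ\sigma$. (Here the roles of $X,Y$ are played by the graph $Y$ of the claim and the complete multipartite graph, respectively.) -}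

module Defs where

open import Data.Nat using (ℕ; zero; suc; _+_; _∸_; _<_; _<ᵇ_)
open import Data.Bool using (if_then_else_)
open import Data.Fin using (Fin; toℕ; _≟_)
open import Data.List using (List; []; _∷_)
open import Data.Product using (Σ; ∃; _×_; _,_)
open import Data.Sum using (_⊎_)
open import Relation.Nullary using (¬_; yes; no)
open import Relation.Binary.PropositionalEquality using (_≡_; _≢_)
open import Relation.Binary.Construct.Closure.ReflexiveTransitive using (Star)

Graph : ℕ → Set₁
Graph n = Fin n → Fin n → Set

-- Bijections V(X) → V(Y) are represented as functions Fin n → Fin n
-- (bijectivity is assumed separately; it is preserved by swaps).
Map : ℕ → Set
Map n = Fin n → Fin n

FriendlySwap : ∀ {n} → Graph n → Graph n → Map n → Map n → Set
FriendlySwap {n} X Y σ σ' =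
  Σ (Fin n) λ a → Σ (Fin n) λ b →
    X a b × Y (σ a) (σ b) × σ' a ≡ σ b × σ' b ≡ σ a ×
    (∀ c → c ≢ a → c ≢ b → σ' c ≡ σ c)

Reachable : ∀ {n} → Graph n → Graph n → Map n → Map n → Set
Reachable X Y = Star (FriendlySwap X Y)

transpose : ∀ {n} → Fin n → Fin n → Fin n → Fin n
transpose u v x with x ≟ u
... | yes _ = v
... | no _ with x ≟ v
...   | yes _ = u
...   | no _ = x

Exchangeable : ∀ {n} → Graph n → Graph n → Map n → Fin n → Fin n → Set
Exchangeable X Y σ u v =
  ∃ λ τ → Reachable X Y σ τ × (∀ x → τ x ≡ transpose u v (σ x))

-- The graph Y of the statement on Fin (2 + ℓ):
-- vertex i (i < ℓ) is p_{i+1}; vertex ℓ is u₁; vertex ℓ+1 is u₂.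
-- Directed edge description; YAdj symmetrises it.
YEdge : (ℓ : ℕ) → Fin (2 + ℓ) → Fin (2 + ℓ) → Set
YEdge ℓ a b =
  (suc (toℕ a) ≡ toℕ b × toℕ b < ℓ)
  ⊎ (toℕ a ≡ ℓ ∸ 1 × (toℕ b ≡ ℓ ⊎ toℕ b ≡ suc ℓ))

YAdj : (ℓ : ℕ) → Graph (2 + ℓ)
YAdj ℓ a b = YEdge ℓ a b ⊎ YEdge ℓ b a

-- Index of the part containing m (0-based vertex label) when consecutive
-- blocks of sizes given by the list are used as parts.
partOf : List ℕ → ℕ → ℕ
partOf [] m = 0
partOf (k ∷ ks) m = if m <ᵇ k then 0 else suc (partOf ks (m ∸ k))

CompleteMultipartite : (n : ℕ) → List ℕ → Graph n
CompleteMultipartite n sizes a b = ¬ (partOf sizes (toℕ a) ≡ partOf sizes (toℕ b))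

-- A label can be pushed across an edge of Y onto a vertex whose label lies in
-- another part of K, so labels slide along the path p₁ … p_ℓ towards the hub p_ℓ.
-- Sliding first brings the two labels of the part {0, 1} onto the leaves u₁ and u₂,
-- and then, using a third part (t ≥ 2), a label onto p_{ℓ-1} whose part differs
-- from that of the hub. Now p_ℓ is the centre of a claw with leaves p_{ℓ-1}, u₁,
-- u₂, and seven swaps at the hub exchange the labels of u₁ and u₂. Finally, the
-- transposition (0 1) is an automorphism of K and swaps are reversible, so this
-- exchange transfers back to the initial bijection.

module Submission where

open import Defs
open import Data.Nat using (ℕ; _≤_; _+_)
open import Data.Fin using (Fin; zero; suc)
open import Data.List using (List; _∷_; length)
open import Data.Nat.ListAction using (sum)
open import Data.List.Relation.Unary.All using (All)
open import Data.List.Relation.Unary.Linked using (Linked)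
open import Relation.Binary.PropositionalEquality using (_≡_)
open import Function.Definitions using (Bijective)

open import Data.Nat using (zero; suc; _<_; s≤s; z≤n)
open import Data.Nat.Properties
  using (≤-refl; ≤-pred; <-trans; <-≤-trans; ≤∧≢⇒<; m≤n⇒m<n∨m≡n; m≤n+m; <⇒≢; n≤1+n; 1+n≢n; n<1+n; m<m+n; ≤-antisym; suc-injective; ≰⇒>; _≤?_)
  renaming (_≟_ to _≟ℕ_)
open import Data.Fin using (toℕ; fromℕ; fromℕ<; _≟_)
open import Data.Fin.Properties using (toℕ-injective; toℕ-fromℕ; toℕ-fromℕ<; toℕ<n)
open import Data.List using ([])
open import Data.List.Relation.Unary.All using (_∷_)
open import Data.Product using (∃; ∃₂; _×_; _,_)
open import Data.Sum using (_⊎_; inj₁; inj₂)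
import Data.Sum as Sum
open import Function using (_∘_)
open import Function.Definitions using (Injective; StrictlySurjective)
open import Function.Consequences.Propositional
  using (surjective⇒strictlySurjective; strictlySurjective⇒surjective)
open import Relation.Nullary using (¬_; yes; no; contradiction)
open import Relation.Nullary.Decidable using (¬?)
open import Relation.Unary using (Pred; Decidable)
open import Relation.Binary using (Symmetric)
open import Relation.Binary.PropositionalEquality
  using (_≢_; _≗_; refl; sym; trans; cong; subst; subst₂; ≢-sym; module ≡-Reasoning)
open import Relation.Binary.Construct.Closure.ReflexiveTransitive using (ε; _◅_; _◅◅_; gmap; reverse)
open import Level using (0ℓ)

module _ {n : ℕ} where

  transpose-left : (u v : Fin n) → transpose u v u ≡ v
  transpose-left u v with u ≟ u
  ... | yes _ = refl
  ... | no u≢u = contradiction refl u≢u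

  transpose-right : (u v : Fin n) → transpose u v v ≡ u
  transpose-right u v with v ≟ u
  ... | yes refl = refl
  ... | no _ with v ≟ v
  ...   | yes _ = refl
  ...   | no v≢v = contradiction refl v≢v

  transpose-other : ∀ {u v x : Fin n} → x ≢ u → x ≢ v → transpose u v x ≡ x
  transpose-other {u} {v} {x} x≢u x≢v with x ≟ u
  ... | yes x≡u = contradiction x≡u x≢u
  ... | no _ with x ≟ v
  ...   | yes x≡v = contradiction x≡v x≢v
  ...   | no _ = refl

  transpose-elim : (P : Fin n → Fin n → Set) {u v : Fin n} → P u v → P v u →
                   (∀ x → x ≢ u → x ≢ v → P x x) → ∀ x → P x (transpose u v x)
  transpose-elim P {u} {v} Puv Pvu Pxx x with x ≟ u
  ... | yes refl = Puv
  ... | no x≢u with x ≟ v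
  ...   | yes refl = Pvu
  ...   | no x≢v = Pxx x x≢u x≢v

  transpose-involutive : (u v x : Fin n) → transpose u v (transpose u v x) ≡ x
  transpose-involutive u v = transpose-elim (λ x y → transpose u v y ≡ x)
    (transpose-right u v) (transpose-left u v) (λ _ x≢u x≢v → transpose-other x≢u x≢v)

  transpose-comm : (u v x : Fin n) → transpose u v x ≡ transpose v u x
  transpose-comm u v = transpose-elim (λ x y → y ≡ transpose v u x)
    (sym (transpose-right v u)) (sym (transpose-left v u)) (λ _ x≢u x≢v → sym (transpose-other x≢v x≢u))

  transpose-conjugate : ∀ {ρ : Fin n → Fin n} → Injective _≡_ _≡_ ρ → (u v x : Fin n) →
                        transpose (ρ u) (ρ v) (ρ x) ≡ ρ (transpose u v x)
  transpose-conjugate {ρ} ρ-inj u v = transpose-elim (λ x y → transpose (ρ u) (ρ v) (ρ x) ≡ ρ y)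
    (transpose-left (ρ u) (ρ v)) (transpose-right (ρ u) (ρ v))
    (λ _ x≢u x≢v → transpose-other (x≢u ∘ ρ-inj) (x≢v ∘ ρ-inj))

  preimage-avoiding : ∀ {ℓ} (R : Pred (Fin n) ℓ) {r₀ r₁} → r₀ ≢ r₁ → R r₀ → R r₁ →
                      ∀ {ρ : Map n} → StrictlySurjective _≡_ ρ → ∀ u → ∃ λ x → x ≢ u × R (ρ x)
  preimage-avoiding R r₀≢r₁ Rr₀ Rr₁ surj u with surj _ | surj _
  ... | x₀ , ρx₀≡r₀ | x₁ , ρx₁≡r₁ with x₀ ≟ u
  ...   | no x₀≢u = x₀ , x₀≢u , subst R (sym ρx₀≡r₀) Rr₀
  ...   | yes refl = x₁ , (λ { refl → r₀≢r₁ (trans (sym ρx₀≡r₀) ρx₁≡r₁) }) , subst R (sym ρx₁≡r₁) Rr₁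

module FriendlySwaps {n : ℕ} (X Y : Graph n) where

  swap : ∀ {σ : Map n} {a b} → X a b → Y (σ a) (σ b) → FriendlySwap X Y σ (σ ∘ transpose a b)
  swap {σ} {a} {b} Xab Yab =
    a , b , Xab , Yab , cong σ (transpose-left a b) , cong σ (transpose-right a b) ,
    λ c c≢a c≢b → cong σ (transpose-other c≢a c≢b)

  swap-transposes : ∀ {σ τ} → FriendlySwap X Y σ τ → ∃₂ λ a b → τ ≗ σ ∘ transpose a b
  swap-transposes {σ} {τ} (a , b , _ , _ , τa , τb , τc) =
    a , b , transpose-elim (λ x y → τ x ≡ σ y) τa τb τc

  swap-bijective : ∀ {σ τ} → FriendlySwap X Y σ τ → Bijective _≡_ _≡_ σ → Bijective _≡_ _≡_ τ
  swap-bijective {σ} {τ} s (σ-inj , σ-surj) with swap-transposes s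
  ... | a , b , τ≗ = τ-inj , strictlySurjective⇒surjective τ-surj
    where
    open ≡-Reasoning
    τ-inj : Injective _≡_ _≡_ τ
    τ-inj {x} {y} τx≡τy = begin
      x                                   ≡⟨ sym (transpose-involutive a b x) ⟩
      transpose a b (transpose a b x)     ≡⟨ cong (transpose a b) (σ-inj (trans (sym (τ≗ x)) (trans τx≡τy (τ≗ y)))) ⟩
      transpose a b (transpose a b y)     ≡⟨ transpose-involutive a b y ⟩
      y                                   ∎
    τ-surj : StrictlySurjective _≡_ τ
    τ-surj y with surjective⇒strictlySurjective σ-surj y
    ... | x , σx≡y = transpose a b x , (begin
      τ (transpose a b x)                 ≡⟨ τ≗ _ ⟩
      σ (transpose a b (transpose a b x)) ≡⟨ cong σ (transpose-involutive a b x) ⟩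
      σ x                                 ≡⟨ σx≡y ⟩
      y                                   ∎)

  reachable-bijective : ∀ {σ τ} → Reachable X Y σ τ → Bijective _≡_ _≡_ σ → Bijective _≡_ _≡_ τ
  reachable-bijective ε σ-bij = σ-bij
  reachable-bijective (s ◅ r) σ-bij = reachable-bijective r (swap-bijective s σ-bij)

  swap-reverse : Symmetric Y → ∀ {σ τ} → FriendlySwap X Y σ τ → FriendlySwap X Y τ σ
  swap-reverse Y-sym (a , b , Xab , Yab , τa , τb , τc) =
    a , b , Xab , subst₂ Y (sym τa) (sym τb) (Y-sym Yab) , sym τb , sym τa , λ c c≢a c≢b → sym (τc c c≢a c≢b)

  swap-map : (π : Map n) → (∀ {x y} → Y x y → Y (π x) (π y)) →
             ∀ {σ τ} → FriendlySwap X Y σ τ → FriendlySwap X Y (π ∘ σ) (π ∘ τ)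
  swap-map π π-hom (a , b , Xab , Yab , τa , τb , τc) =
    a , b , Xab , π-hom Yab , cong π τa , cong π τb , λ c c≢a c≢b → cong π (τc c c≢a c≢b)

  reachable-resp-≗ : ∀ {σ σ′ τ} → σ′ ≗ σ → Reachable X Y σ τ → ∃ λ τ′ → Reachable X Y σ′ τ′ × τ′ ≗ τ
  reachable-resp-≗ σ′≗σ ε = _ , ε , σ′≗σ
  reachable-resp-≗ σ′≗σ ((a , b , Xab , Yab , τa , τb , τc) ◅ r) =
    _ , (a , b , Xab , subst₂ Y (sym (σ′≗σ a)) (sym (σ′≗σ b)) Yab ,
         trans τa (sym (σ′≗σ b)) , trans τb (sym (σ′≗σ a)) , λ c c≢a c≢b → trans (τc c c≢a c≢b) (sym (σ′≗σ c))) ◅ r ,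
    λ _ → refl

  -- If (u v) is an automorphism of Y, then σ ⇝ ρ implies (u v) ∘ ρ ⇝ (u v) ∘ σ,
  -- so σ ⇝ ρ ⇝ (u v) ∘ ρ ⇝ (u v) ∘ σ.
  exchangeable-reachable : Symmetric Y → ∀ {u v} → (∀ {x y} → Y x y → Y (transpose u v x) (transpose u v y)) →
                           ∀ {σ ρ} → Reachable X Y σ ρ → Exchangeable X Y ρ u v → Exchangeable X Y σ u v
  exchangeable-reachable Y-sym {u} {v} uv-hom σ⇝ρ (τ , ρ⇝τ , τ≗)
    with reachable-resp-≗ τ≗ (reverse (swap-reverse Y-sym) (gmap (transpose u v ∘_) (swap-map (transpose u v) uv-hom) σ⇝ρ))
  ... | τ′ , τ⇝τ′ , τ′≗ = τ′ , σ⇝ρ ◅◅ ρ⇝τ ◅◅ τ⇝τ′ , τ′≗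

module Pushing {n : ℕ} {X K : Graph n} {R : Pred (Fin n) 0ℓ} (R? : Decidable R)
               (separates : ∀ {a b} → R a → ¬ R b → K a b) where
  open FriendlySwaps X K

  push : ∀ {a b} → X a b → ∀ ρ → R (ρ a) →
         ∃ λ ρ′ → Reachable X K ρ ρ′ × R (ρ′ b) × (∀ z → z ≢ a → z ≢ b → ρ′ z ≡ ρ z)
  push {a} {b} Xab ρ Rρa with R? (ρ b)
  ... | yes Rρb = ρ , ε , Rρb , λ _ _ _ → refl
  ... | no ¬Rρb = ρ ∘ transpose a b , swap Xab (separates Rρa ¬Rρb) ◅ ε ,
                  subst R (sym (cong ρ (transpose-right a b))) Rρa ,
                  λ z z≢a z≢b → cong ρ (transpose-other z≢a z≢b)

module ClawExchange {n : ℕ} {X K : Graph n} (K-sym : Symmetric K)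
                    {h p u₁ u₂ : Fin n} (h-p : X h p) (h-u₁ : X h u₁) (h-u₂ : X h u₂)
                    (p≢h : p ≢ h) (u₁≢h : u₁ ≢ h) (u₂≢h : u₂ ≢ h)
                    (p≢u₁ : p ≢ u₁) (p≢u₂ : p ≢ u₂) (u₁≢u₂ : u₁ ≢ u₂)
                    (ρ₀ : Map n) where
  open FriendlySwaps X K

  record Labelling (c d a b : Fin n) : Set where
    field
      config    : Map n
      reached   : Reachable X K ρ₀ config
      at-h      : config h ≡ c
      at-p      : config p ≡ d
      at-u₁     : config u₁ ≡ a
      at-u₂     : config u₂ ≡ b
      elsewhere : ∀ x → x ≢ h → x ≢ p → x ≢ u₁ → x ≢ u₂ → config x ≡ ρ₀ x

  start : Labelling (ρ₀ h) (ρ₀ p) (ρ₀ u₁) (ρ₀ u₂)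
  start = record { config = ρ₀ ; reached = ε ; at-h = refl ; at-p = refl ; at-u₁ = refl ; at-u₂ = refl
                 ; elsewhere = λ _ _ _ _ _ → refl }

  module _ {c d a b : Fin n} (L : Labelling c d a b) where
    open Labelling L

    private
      swap-hub : ∀ {q y} → X h q → config q ≡ y → K c y → Reachable X K ρ₀ (config ∘ transpose h q)
      swap-hub h-q at-q Kcy = reached ◅◅ swap h-q (subst₂ K (sym at-h) (sym at-q) Kcy) ◅ ε

      unmoved : ∀ {q x} → x ≢ h → x ≢ q → config (transpose h q x) ≡ config x
      unmoved x≢h x≢q = cong config (transpose-other x≢h x≢q)

    move-p : K c d → Labelling d c a b
    move-p Kcd = record
      { config = config ∘ transpose h p ; reached = swap-hub h-p at-p Kcd
      ; at-h = trans (cong config (transpose-left h p)) at-p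
      ; at-p = trans (cong config (transpose-right h p)) at-h
      ; at-u₁ = trans (unmoved u₁≢h (≢-sym p≢u₁)) at-u₁
      ; at-u₂ = trans (unmoved u₂≢h (≢-sym p≢u₂)) at-u₂
      ; elsewhere = λ x x≢h x≢p x≢u₁ x≢u₂ → trans (unmoved x≢h x≢p) (elsewhere x x≢h x≢p x≢u₁ x≢u₂) }

    move-u₁ : K c a → Labelling a d c b
    move-u₁ Kca = record
      { config = config ∘ transpose h u₁ ; reached = swap-hub h-u₁ at-u₁ Kca
      ; at-h = trans (cong config (transpose-left h u₁)) at-u₁
      ; at-p = trans (unmoved p≢h p≢u₁) at-p
      ; at-u₁ = trans (cong config (transpose-right h u₁)) at-h
      ; at-u₂ = trans (unmoved u₂≢h (≢-sym u₁≢u₂)) at-u₂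
      ; elsewhere = λ x x≢h x≢p x≢u₁ x≢u₂ → trans (unmoved x≢h x≢u₁) (elsewhere x x≢h x≢p x≢u₁ x≢u₂) }

    move-u₂ : K c b → Labelling b d a c
    move-u₂ Kcb = record
      { config = config ∘ transpose h u₂ ; reached = swap-hub h-u₂ at-u₂ Kcb
      ; at-h = trans (cong config (transpose-left h u₂)) at-u₂
      ; at-p = trans (unmoved p≢h p≢u₂) at-p
      ; at-u₁ = trans (unmoved u₁≢h u₁≢u₂) at-u₁
      ; at-u₂ = trans (cong config (transpose-right h u₂)) at-h
      ; elsewhere = λ x x≢h x≢p x≢u₁ x≢u₂ → trans (unmoved x≢h x≢u₂) (elsewhere x x≢h x≢p x≢u₁ x≢u₂) }

  -- Seven hub swaps; none of them swaps a with b, which need not be adjacent in K.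
  leaves-exchanged : ∀ {c d a b} → K a c → K a d → K b c → K b d → K c d → Labelling c d a b → Labelling c d b a
  leaves-exchanged Kac Kad Kbc Kbd Kcd L =
    move-u₂ (move-p (move-u₂ (move-u₁ (move-u₂ (move-p (move-u₁ L (K-sym Kac)) Kad) (K-sym Kbd)) Kbc) Kcd) (K-sym Kad)) Kac

  agrees-off-leaves : ∀ {a b} (L : Labelling (ρ₀ h) (ρ₀ p) a b) → let open Labelling L in
               ∀ x → x ≢ u₁ → x ≢ u₂ → config x ≡ ρ₀ x
  agrees-off-leaves L x x≢u₁ x≢u₂ with x ≟ h | x ≟ p
  ... | yes refl | _ = Labelling.at-h L
  ... | no _ | yes refl = Labelling.at-p L
  ... | no x≢h | no x≢p = Labelling.elsewhere L x x≢h x≢p x≢u₁ x≢u₂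

  claw-leaves-exchangeable : let c = ρ₀ h ; d = ρ₀ p ; a = ρ₀ u₁ ; b = ρ₀ u₂ in
                             K a c → K a d → K b c → K b d → K c d →
                             ∃ λ τ → Reachable X K ρ₀ τ × τ ≗ ρ₀ ∘ transpose u₁ u₂
  claw-leaves-exchangeable Kac Kad Kbc Kbd Kcd =
    config , reached , transpose-elim (λ x y → config x ≡ ρ₀ y) at-u₁ at-u₂ (agrees-off-leaves L)
    where
    L : Labelling (ρ₀ h) (ρ₀ p) (ρ₀ u₂) (ρ₀ u₁)
    L = leaves-exchanged Kac Kad Kbc Kbd Kcd start
    open Labelling L

module TwoLeafPath (m : ℕ) where

  ℓ : ℕ
  ℓ = suc (suc m)

  X : Graph (2 + ℓ)
  X = YAdj ℓ

  X-sym : Symmetric X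
  X-sym = Sum.swap

  path : ∀ {i} → .(i < ℓ) → Fin (2 + ℓ)
  path i<ℓ = fromℕ< (<-≤-trans i<ℓ (m≤n+m ℓ 2))

  toℕ-path : ∀ {i} → .(i<ℓ : i < ℓ) → toℕ (path i<ℓ) ≡ i
  toℕ-path i<ℓ = toℕ-fromℕ< _

  m<ℓ : m < ℓ
  m<ℓ = <-trans (n<1+n m) ≤-refl

  pℓ pℓ₋₁ u₁ u₂ : Fin (2 + ℓ)
  pℓ = path {suc m} ≤-refl
  pℓ₋₁ = path m<ℓ
  u₁ = fromℕ< (<-trans (n<1+n ℓ) (n<1+n (suc ℓ)))
  u₂ = fromℕ (suc ℓ)

  toℕ-pℓ : toℕ pℓ ≡ suc m
  toℕ-pℓ = toℕ-path {suc m} ≤-refl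

  toℕ-u₁ : toℕ u₁ ≡ ℓ
  toℕ-u₁ = toℕ-fromℕ< (<-trans (n<1+n ℓ) (n<1+n (suc ℓ)))

  path-edge : ∀ {i} (i+1<ℓ : suc i < ℓ) → X (path (<-trans (n<1+n i) i+1<ℓ)) (path i+1<ℓ)
  path-edge {i} i+1<ℓ = inj₁ (inj₁ (trans (cong suc (toℕ-path (<-trans (n<1+n i) i+1<ℓ))) (sym (toℕ-path i+1<ℓ)) ,
                                    subst (_< ℓ) (sym (toℕ-path i+1<ℓ)) i+1<ℓ))

  ≢-path : ∀ {i z} → .(i<ℓ : i < ℓ) → i < toℕ z → z ≢ path i<ℓ
  ≢-path i<ℓ i<z refl = <⇒≢ i<z (sym (toℕ-path i<ℓ))

  Leaf : Fin (2 + ℓ) → Set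
  Leaf y = ℓ ≤ toℕ y

  leaf-u₁ : Leaf u₁
  leaf-u₁ = subst (ℓ ≤_) (sym toℕ-u₁) ≤-refl

  leaf-u₂ : Leaf u₂
  leaf-u₂ = subst (ℓ ≤_) (sym (toℕ-fromℕ (suc ℓ))) (n≤1+n ℓ)

  u₁≢u₂ : u₁ ≢ u₂
  u₁≢u₂ u₁≡u₂ = 1+n≢n (trans (sym (toℕ-fromℕ (suc ℓ))) (trans (cong toℕ (sym u₁≡u₂)) toℕ-u₁))

  leaf-index : ∀ {y} → Leaf y → toℕ y ≡ ℓ ⊎ toℕ y ≡ suc ℓ
  leaf-index {y} ℓ≤y with m≤n⇒m<n∨m≡n ℓ≤y
  ... | inj₂ ℓ≡y = inj₁ (sym ℓ≡y)
  ... | inj₁ ℓ<y = inj₂ (≤-antisym (≤-pred (toℕ<n y)) ℓ<y)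

  private
    same-index : ∀ {y z : Fin (2 + ℓ)} {k} → toℕ y ≡ k → toℕ z ≡ k → y ≡ z
    same-index ey ez = toℕ-injective (trans ey (sym ez))

  leaf-other : ∀ {U U′ x} → Leaf U → Leaf U′ → U ≢ U′ → Leaf x → x ≢ U → x ≡ U′
  leaf-other lU lU′ U≢U′ lx x≢U with leaf-index lU | leaf-index lU′ | leaf-index lx
  ... | inj₁ eU | inj₁ eU′ | _      = contradiction (same-index eU eU′) U≢U′
  ... | inj₂ eU | inj₂ eU′ | _      = contradiction (same-index eU eU′) U≢U′
  ... | inj₁ eU | _       | inj₁ ex = contradiction (same-index ex eU) x≢U
  ... | inj₂ eU | _       | inj₂ ex = contradiction (same-index ex eU) x≢U
  ... | _       | inj₁ eU′ | inj₁ ex = same-index ex eU′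
  ... | _       | inj₂ eU′ | inj₂ ex = same-index ex eU′

  leaf-or-path : ∀ x → Leaf x ⊎ toℕ x ≤ suc m
  leaf-or-path x with ℓ ≤? toℕ x
  ... | yes ℓ≤x = inj₁ ℓ≤x
  ... | no ℓ≰x = inj₂ (≤-pred (≰⇒> ℓ≰x))

  hub-leaf : ∀ {y} → Leaf y → X pℓ y
  hub-leaf ly = inj₁ (inj₂ (toℕ-pℓ , leaf-index ly))

  leaf≢path : ∀ {i y} → (i<ℓ : i < ℓ) → Leaf y → y ≢ path i<ℓ
  leaf≢path i<ℓ ly = ≢-path i<ℓ (<-≤-trans i<ℓ ly)

  pℓ₋₁≢pℓ : pℓ₋₁ ≢ pℓ
  pℓ₋₁≢pℓ = ≢-sym (≢-path m<ℓ (subst (m <_) (sym toℕ-pℓ) (n<1+n m)))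

  u₁≢pℓ : u₁ ≢ pℓ
  u₁≢pℓ = leaf≢path ≤-refl leaf-u₁

  u₂≢pℓ : u₂ ≢ pℓ
  u₂≢pℓ = leaf≢path ≤-refl leaf-u₂

  u₁≢pℓ₋₁ : u₁ ≢ pℓ₋₁
  u₁≢pℓ₋₁ = leaf≢path m<ℓ leaf-u₁

  u₂≢pℓ₋₁ : u₂ ≢ pℓ₋₁
  u₂≢pℓ₋₁ = leaf≢path m<ℓ leaf-u₂

  below-hub : ∀ z → z ≢ pℓ → z ≢ u₁ → z ≢ u₂ → toℕ z ≤ m
  below-hub z z≢pℓ z≢u₁ z≢u₂ with leaf-or-path z
  ... | inj₁ lz = contradiction (leaf-other leaf-u₁ leaf-u₂ u₁≢u₂ lz z≢u₁) z≢u₂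
  ... | inj₂ z≤1+m = ≤-pred (≤∧≢⇒< z≤1+m (λ z≡1+m → z≢pℓ (same-index z≡1+m toℕ-pℓ)))

  module Sliding {K : Graph (2 + ℓ)} {R : Pred (Fin (2 + ℓ)) 0ℓ} (R? : Decidable R)
                 (separates : ∀ {a b} → R a → ¬ R b → K a b) where
    open Pushing {X = X} R? separates
    open FriendlySwaps X K

    slide : ∀ i (i<ℓ : i < ℓ) ρ x → toℕ x ≤ i → R (ρ x) →
            ∃ λ ρ′ → Reachable X K ρ ρ′ × R (ρ′ (path i<ℓ)) × (∀ z → i < toℕ z → ρ′ z ≡ ρ z)
    slide i i<ℓ ρ x x≤i Rρx with m≤n⇒m<n∨m≡n x≤i
    ... | inj₂ x≡i = ρ , ε , subst (R ∘ ρ) (toℕ-injective (trans x≡i (sym (toℕ-path i<ℓ)))) Rρx , λ _ _ → refl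
    slide zero    _ _ _ _ _ | inj₁ ()
    slide (suc i) i+1<ℓ ρ x _ Rρx | inj₁ (s≤s x≤i) with slide i (<-trans (n<1+n i) i+1<ℓ) ρ x x≤i Rρx
    ... | ρ₁ , ρ⇝ρ₁ , Rρ₁pᵢ , keep₁ with push (path-edge i+1<ℓ) ρ₁ Rρ₁pᵢ
    ... | ρ₂ , ρ₁⇝ρ₂ , Rρ₂pᵢ₊₁ , keep₂ = ρ₂ , ρ⇝ρ₁ ◅◅ ρ₁⇝ρ₂ , Rρ₂pᵢ₊₁ , keep
      where
      keep : ∀ z → suc i < toℕ z → ρ₂ z ≡ ρ z
      keep z i+1<z = trans (keep₂ z (≢-path (<-trans (n<1+n i) i+1<ℓ) i<z) (≢-path i+1<ℓ i+1<z)) (keep₁ z i<z)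
        where
        i<z : i < toℕ z
        i<z = <-trans (n<1+n i) i+1<z

    to-hub : ∀ {U U′} → Leaf U → Leaf U′ → U ≢ U′ → ∀ ρ x → x ≢ U → R (ρ x) →
             ∃ λ ρ′ → Reachable X K ρ ρ′ × R (ρ′ pℓ) × (x ≢ U′ → ρ′ U′ ≡ ρ U′)
    to-hub {U′ = U′} lU lU′ U≢U′ ρ x x≢U Rρx with leaf-or-path x
    ... | inj₂ x≤ with slide (suc m) ≤-refl ρ x x≤ Rρx
    ...   | ρ′ , ρ⇝ρ′ , Rρ′pℓ , keep = ρ′ , ρ⇝ρ′ , Rρ′pℓ , λ _ → keep U′ lU′
    to-hub lU lU′ U≢U′ ρ x x≢U Rρx | inj₁ lx with leaf-other lU lU′ U≢U′ lx x≢U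
    ...   | refl with push (X-sym (hub-leaf lx)) ρ Rρx
    ...     | ρ′ , ρ⇝ρ′ , Rρ′pℓ , _ = ρ′ , ρ⇝ρ′ , Rρ′pℓ , λ x≢x → contradiction refl x≢x

    fill-leaf : ∀ {U U′} → Leaf U → Leaf U′ → U ≢ U′ → ∀ ρ x → R (ρ x) →
                ∃ λ ρ′ → Reachable X K ρ ρ′ × R (ρ′ U) × (x ≢ U′ → ρ′ U′ ≡ ρ U′)
    fill-leaf {U} {U′} lU lU′ U≢U′ ρ x Rρx with R? (ρ U)
    ... | yes RρU = ρ , ε , RρU , λ _ → refl
    ... | no ¬RρU with to-hub lU lU′ U≢U′ ρ x (λ { refl → ¬RρU Rρx }) Rρx
    ...   | ρ₁ , ρ⇝ρ₁ , Rρ₁pℓ , keep₁ with push (hub-leaf lU) ρ₁ Rρ₁pℓ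
    ...     | ρ₂ , ρ₁⇝ρ₂ , Rρ₂U , keep₂ =
      ρ₂ , ρ⇝ρ₁ ◅◅ ρ₁⇝ρ₂ , Rρ₂U , λ x≢U′ → trans (keep₂ U′ (leaf≢path ≤-refl lU′) (≢-sym U≢U′)) (keep₁ x≢U′)

    fill-leaves : ∀ {r₀ r₁} → r₀ ≢ r₁ → R r₀ → R r₁ → ∀ ρ → Bijective _≡_ _≡_ ρ →
                  ∃ λ ρ′ → Reachable X K ρ ρ′ × R (ρ′ u₁) × R (ρ′ u₂)
    fill-leaves {r₀} r₀≢r₁ Rr₀ Rr₁ ρ ρ-bij@(_ , ρ-surj) with surjective⇒strictlySurjective ρ-surj r₀
    ... | x , ρx≡r₀ with fill-leaf leaf-u₂ leaf-u₁ (≢-sym u₁≢u₂) ρ x (subst R (sym ρx≡r₀) Rr₀)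
    ... | ρ₁ , ρ⇝ρ₁ , Rρ₁u₂ , _ with reachable-bijective ρ⇝ρ₁ ρ-bij
    ... | _ , ρ₁-surj with preimage-avoiding R r₀≢r₁ Rr₀ Rr₁ (surjective⇒strictlySurjective ρ₁-surj) u₂
    ... | y , y≢u₂ , Rρ₁y with fill-leaf leaf-u₁ leaf-u₂ u₁≢u₂ ρ₁ y Rρ₁y
    ... | ρ₂ , ρ₁⇝ρ₂ , Rρ₂u₁ , keep = ρ₂ , ρ⇝ρ₁ ◅◅ ρ₁⇝ρ₂ , Rρ₂u₁ , subst R (sym (keep y≢u₂)) Rρ₁u₂

partOf-size : ∀ k ks → partOf (k ∷ ks) k ≡ suc (partOf ks 0)
partOf-size zero    ks = refl
partOf-size (suc k) ks = partOf-size k ks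

module MultipartiteParts {n : ℕ} (sizes : List ℕ) where

  K : Graph n
  K = CompleteMultipartite n sizes

  part : Fin n → ℕ
  part y = partOf sizes (toℕ y)

  K-sym : Symmetric K
  K-sym ¬same same = ¬same (sym same)

  separates-by-part : (Q : ℕ → Set) → ∀ {a b} → Q (part a) → ¬ Q (part b) → K a b
  separates-by-part Q Qa ¬Qb same = ¬Qb (subst Q same Qa)

  part-preserving-hom : ∀ {π : Map n} → (∀ y → part (π y) ≡ part y) → ∀ {x y} → K x y → K (π x) (π y)
  part-preserving-hom π-part {x} {y} Kxy same = Kxy (trans (sym (π-part x)) (trans same (π-part y)))

module FirstPartOfSizeTwo {n : ℕ} (ks : List ℕ) where
  open MultipartiteParts {suc (suc n)} (2 ∷ ks) public

  part-zero : ∀ {y} → part y ≡ 0 → y ≡ zero ⊎ y ≡ suc zero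
  part-zero {zero}        _ = inj₁ refl
  part-zero {suc zero}    _ = inj₂ refl
  part-zero {suc (suc _)} ()

  transpose-zero-one-hom : ∀ {x y} → K x y → K (transpose zero (suc zero) x) (transpose zero (suc zero) y)
  transpose-zero-one-hom {x} {y} = part-preserving-hom {π = transpose zero (suc zero)}
    (transpose-elim (λ x y → part y ≡ part x) refl refl (λ _ _ _ → refl)) {x} {y}

  transpose-part-zero : ∀ {a b} → part a ≡ 0 → part b ≡ 0 → a ≢ b → transpose a b ≗ transpose zero (suc zero)
  transpose-part-zero {a} {b} pa pb a≢b with part-zero {a} pa | part-zero {b} pb
  ... | inj₁ refl | inj₁ refl = contradiction refl a≢b
  ... | inj₁ refl | inj₂ refl = λ _ → refl
  ... | inj₂ refl | inj₁ refl = transpose-comm (suc zero) zero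
  ... | inj₂ refl | inj₂ refl = contradiction refl a≢b

  part-zero-pigeonhole : ∀ {a b c} → part a ≡ 0 → part b ≡ 0 → part c ≡ 0 → a ≢ b → c ≡ a ⊎ c ≡ b
  part-zero-pigeonhole {a} {b} {c} pa pb pc a≢b with part-zero {a} pa | part-zero {b} pb | part-zero {c} pc
  ... | inj₁ refl | inj₁ refl | _ = contradiction refl a≢b
  ... | inj₂ refl | inj₂ refl | _ = contradiction refl a≢b
  ... | inj₁ refl | _ | inj₁ refl = inj₁ refl
  ... | inj₂ refl | _ | inj₂ refl = inj₁ refl
  ... | _ | inj₁ refl | inj₁ refl = inj₂ refl
  ... | _ | inj₂ refl | inj₂ refl = inj₂ refl

module Phases (m k₁ k₂ : ℕ) (rest : List ℕ) (sum≡ : sum (suc k₁ ∷ suc k₂ ∷ rest) ≡ 2 + m) where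
  open TwoLeafPath m
  open FirstPartOfSizeTwo {ℓ} (suc k₁ ∷ suc k₂ ∷ rest)
  open FriendlySwaps X K

  module InPartZero = Sliding {K = K} {R = λ y → part y ≡ 0} (λ y → part y ≟ℕ 0) (λ {a} {b} → separates-by-part (_≡ 0) {a} {b})
  module NotInPart (c : ℕ) = Sliding {K = K} {R = λ y → part y ≢ c} (λ y → ¬? (part y ≟ℕ c)) (λ {a} {b} → separates-by-part (_≢ c) {a} {b})

  k₁<1+m : k₁ < suc m
  k₁<1+m = subst (k₁ <_) (suc-injective sum≡) (m<m+n k₁ (s≤s z≤n))

  first-of-part-two : Fin (2 + ℓ)
  first-of-part-two = fromℕ< {2 + suc k₁} (s≤s (s≤s (s≤s k₁<1+m)))

  part-first-of-part-two : part first-of-part-two ≡ 2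
  part-first-of-part-two = trans (cong (partOf (2 ∷ suc k₁ ∷ suc k₂ ∷ rest)) (toℕ-fromℕ< (s≤s (s≤s (s≤s k₁<1+m)))))
                                 (cong suc (partOf-size (suc k₁) (suc k₂ ∷ rest)))

  -- The only use of t ≥ 2: besides {0, 1} there are parts 1 and 2 to choose from.
  another-part : ∀ c → ∃ λ w → part w ≢ 0 × part w ≢ c
  another-part c with c ≟ℕ 1
  ... | yes refl = first-of-part-two , subst (_≢ 0) (sym part-first-of-part-two) (λ ()) ,
                                       subst (_≢ 1) (sym part-first-of-part-two) (λ ())
  ... | no c≢1 = suc (suc zero) , (λ ()) , ≢-sym c≢1

  leaves-in-part-zero : ∀ ρ → Bijective _≡_ _≡_ ρ →
                        ∃ λ ρ′ → Reachable X K ρ ρ′ × part (ρ′ u₁) ≡ 0 × part (ρ′ u₂) ≡ 0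
  leaves-in-part-zero = InPartZero.fill-leaves {r₀ = zero} {r₁ = suc zero} (λ ()) refl refl

  separate-hub-and-neighbour : ∀ ρ → Bijective _≡_ _≡_ ρ → part (ρ u₁) ≡ 0 → part (ρ u₂) ≡ 0 →
    ∃ λ ρ′ → Reachable X K ρ ρ′ × part (ρ′ u₁) ≡ 0 × part (ρ′ u₂) ≡ 0 × part (ρ′ pℓ₋₁) ≢ part (ρ′ pℓ)
  separate-hub-and-neighbour ρ (_ , ρ-surj) a₁ a₂ with another-part (part (ρ pℓ))
  ... | w , w∉0 , w∉c with surjective⇒strictlySurjective ρ-surj w
  ... | z , refl with NotInPart.slide (part (ρ pℓ)) m m<ℓ ρ z z≤m w∉c
    where
    z≤m : toℕ z ≤ m
    z≤m = below-hub z (λ { refl → w∉c refl }) (λ { refl → w∉0 a₁ }) (λ { refl → w∉0 a₂ })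
  ... | ρ′ , ρ⇝ρ′ , differs , keep =
    ρ′ , ρ⇝ρ′ , trans (cong part (keep u₁ (above-m leaf-u₁))) a₁ , trans (cong part (keep u₂ (above-m leaf-u₂))) a₂ ,
    λ same → differs (trans same (cong part (keep pℓ (subst (m <_) (sym toℕ-pℓ) (n<1+n m)))))
    where
    above-m : ∀ {y} → Leaf y → m < toℕ y
    above-m ly = <-trans (n<1+n m) ly

  module Claw = ClawExchange {X = X} {K = K} (λ {x} {y} → K-sym {x} {y})
    (X-sym (path-edge {m} ≤-refl)) (hub-leaf leaf-u₁) (hub-leaf leaf-u₂)
    pℓ₋₁≢pℓ u₁≢pℓ u₂≢pℓ (≢-sym u₁≢pℓ₋₁) (≢-sym u₂≢pℓ₋₁) u₁≢u₂

  exchange-zero-one : ∀ ρ → Bijective _≡_ _≡_ ρ → part (ρ u₁) ≡ 0 → part (ρ u₂) ≡ 0 →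
                      part (ρ pℓ₋₁) ≢ part (ρ pℓ) → Exchangeable X K ρ zero (suc zero)
  exchange-zero-one ρ (ρ-inj , _) a₁ a₂ d≢c =
    let τ , ρ⇝τ , τ≗ = Claw.claw-leaves-exchangeable ρ
                          (zero-adjacent u₁ pℓ a₁ (≢-sym u₁≢pℓ) (≢-sym u₂≢pℓ))
                          (zero-adjacent u₁ pℓ₋₁ a₁ (≢-sym u₁≢pℓ₋₁) (≢-sym u₂≢pℓ₋₁))
                          (zero-adjacent u₂ pℓ a₂ (≢-sym u₁≢pℓ) (≢-sym u₂≢pℓ))
                          (zero-adjacent u₂ pℓ₋₁ a₂ (≢-sym u₁≢pℓ₋₁) (≢-sym u₂≢pℓ₋₁))
                          (λ same → d≢c (sym same))
    in τ , ρ⇝τ , λ x → begin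
         τ x                                    ≡⟨ τ≗ x ⟩
         ρ (transpose u₁ u₂ x)                  ≡⟨ sym (transpose-conjugate ρ-inj u₁ u₂ x) ⟩
         transpose (ρ u₁) (ρ u₂) (ρ x)          ≡⟨ transpose-part-zero a₁ a₂ (u₁≢u₂ ∘ ρ-inj) (ρ x) ⟩
         transpose zero (suc zero) (ρ x)        ∎
    where
    open ≡-Reasoning
    zero-adjacent : ∀ u z → part (ρ u) ≡ 0 → z ≢ u₁ → z ≢ u₂ → K (ρ u) (ρ z)
    zero-adjacent u z pu z≢u₁ z≢u₂ same with part-zero-pigeonhole a₁ a₂ (trans (sym same) pu) (u₁≢u₂ ∘ ρ-inj)
    ... | inj₁ ρz≡ρu₁ = z≢u₁ (ρ-inj ρz≡ρu₁)
    ... | inj₂ ρz≡ρu₂ = z≢u₂ (ρ-inj ρz≡ρu₂)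

proposition5p4 : (ℓ : ℕ) → 2 ≤ ℓ → (ks : List ℕ) → 2 ≤ length ks →
    All (1 ≤_) ks → Linked _≤_ ks → sum ks ≡ ℓ →
    (σ : Fin (2 + ℓ) → Fin (2 + ℓ)) → Bijective _≡_ _≡_ σ →
    Exchangeable (YAdj ℓ) (CompleteMultipartite (2 + ℓ) (2 ∷ ks)) σ zero (suc zero)
proposition5p4 (suc (suc m)) (s≤s (s≤s z≤n)) (suc k₁ ∷ suc k₂ ∷ rest) _ _ _ sum≡ σ σ-bij =
  let ρ₁ , σ⇝ρ₁ , u₁∈part₀ , u₂∈part₀ = leaves-in-part-zero σ σ-bij
      ρ₂ , ρ₁⇝ρ₂ , u₁∈part₀′ , u₂∈part₀′ , parts-differ =
        separate-hub-and-neighbour ρ₁ (reachable-bijective σ⇝ρ₁ σ-bij) u₁∈part₀ u₂∈part₀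
      σ⇝ρ₂ = σ⇝ρ₁ ◅◅ ρ₁⇝ρ₂
  in exchangeable-reachable (λ {x} {y} → K-sym {x} {y}) (λ {x} {y} → transpose-zero-one-hom {x} {y}) σ⇝ρ₂
       (exchange-zero-one ρ₂ (reachable-bijective σ⇝ρ₂ σ-bij) u₁∈part₀′ u₂∈part₀′ parts-differ)
  where
  open TwoLeafPath m
  open FirstPartOfSizeTwo {ℓ} (suc k₁ ∷ suc k₂ ∷ rest)
  open FriendlySwaps X K
  open Phases m k₁ k₂ rest sum≡
proposition5p4 (suc (suc _)) _ (_ ∷ []) (s≤s ()) _ _ _ _ _
proposition5p4 (suc (suc _)) _ (zero ∷ _) _ (() ∷ _) _ _ _ _
proposition5p4 (suc (suc _)) _ (suc _ ∷ zero ∷ _) _ (_ ∷ () ∷ _) _ _ _ _
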